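{- Let $G$ and $H$ be finite simple graphs, let $k=|H|-\alpha(H)$, and suppose $H$ is not an edgeless graph (i.e. $H\not\cong\overline{K}_n$ for every $n$). Then $$\chi_{\rho}(G\circ H)\leq |G|\cdot|H|-\alpha(G)\alpha(H)-\sum_{i=2}^{k+1} \rho_i(G)+k+1.$$
   Context: All graphs are finite and simple; $|G|$ denotes the number of vertices of $G$ and $d_G(u,v)$ the distance in $G$ (infinite between different components). For a positive integer $t$, a set $X\subseteq V(G)$ is a $t$-packing if any two distinct vertices of $X$ are at distance more than $t$; $\rho_t(G)$ is the maximum size of a $t$-packing, and $\rho_1(G)=\alpha(G)$ is the independence number. A $k$-packing coloring of $G$ is a map $c:V(G)\to\{1,\dots,k\}$ such that $c(u)=c(v)=i$ with $u\neq v$ implies $d_G(u,v)>i$; the packing chromatic number $\chi_\rho(G)$ is the least such $k$. The lexicographic product $G\circ H$ has vertex set $V(G)\times V(H)$, with $(g_1,h_1)$ adjacent to $(g_2,h_2)$ iff $g_1g_2\in E(G)$, or $g_1=g_2$ and $h_1h_2\in E(H)$. $\overline{K}_n$ denotes the graph on $n$ vertices with no edges. -}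

module Defs where

open import Data.Bool using (Bool; true; false; _∧_; _∨_)
open import Data.Bool.Properties using (∨-comm)
open import Data.Nat using (ℕ; zero; suc; _+_; _*_; _≤_)
open import Data.Fin using (Fin; toℕ; remQuot)
open import Data.Fin.Properties using (_≟_)
open import Data.Product using (Σ; _×_; _,_; proj₁; proj₂; ∃)
open import Data.List using (List; map; upTo)
open import Data.Nat.ListAction using (sum)
open import Relation.Nullary using (¬_; yes; no)
open import Relation.Nullary.Decidable using (⌊_⌋)
open import Relation.Binary.PropositionalEquality using (_≡_; _≢_; refl; sym; cong)

record Graph : Set where
  field
    order : ℕ
    adj   : Fin order → Fin order → Bool
    adj-sym : ∀ u v → adj u v ≡ adj v u
    adj-irr : ∀ u → adj u u ≡ false
open Graph public

∣_∣ᵥ : Graph → ℕ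
∣ G ∣ᵥ = order G

V : Graph → Set
V G = Fin (order G)

data Walk (G : Graph) : V G → V G → ℕ → Set where
  here : ∀ {u} → Walk G u u zero
  step : ∀ {u w v ℓ} → adj G u w ≡ true → Walk G w v ℓ → Walk G u v (suc ℓ)

DistLe : (G : Graph) → V G → V G → ℕ → Set
DistLe G u v t = Σ ℕ λ ℓ → ℓ ≤ t × Walk G u v ℓ

-- d_G(u,v) > t  (distance is infinite between different components)
DistGt : (G : Graph) → V G → V G → ℕ → Set
DistGt G u v t = ¬ DistLe G u v t

HasPacking : (G : Graph) → ℕ → ℕ → Set
HasPacking G t m =
  Σ (Fin m → V G) λ f → ∀ i j → i ≢ j → DistGt G (f i) (f j) t

IsPackingNumber : (G : Graph) → ℕ → ℕ → Set
IsPackingNumber G t r = HasPacking G t r × (∀ m → HasPacking G t m → m ≤ r)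

HasIndependent : (G : Graph) → ℕ → Set
HasIndependent G m =
  Σ (Fin m → V G) λ f → (∀ i j → i ≢ j → f i ≢ f j) × (∀ i j → adj G (f i) (f j) ≡ false)

IsIndependenceNumber : (G : Graph) → ℕ → Set
IsIndependenceNumber G a = HasIndependent G a × (∀ m → HasIndependent G m → m ≤ a)

-- k-packing colouring; colour c ∈ Fin k stands for the colour toℕ c + 1 ∈ {1..k}.
IsPackingColoring : (G : Graph) (k : ℕ) → (V G → Fin k) → Set
IsPackingColoring G k c =
  ∀ u v → u ≢ v → c u ≡ c v → DistGt G u v (suc (toℕ (c u)))

HasPackingColoring : Graph → ℕ → Set
HasPackingColoring G k = Σ (V G → Fin k) (IsPackingColoring G k)

IsPackingChromaticNumber : Graph → ℕ → Set
IsPackingChromaticNumber G χ =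
  HasPackingColoring G χ × (∀ k → HasPackingColoring G k → χ ≤ k)

Edgeless : Graph → Set
Edgeless G = ∀ u v → adj G u v ≡ false

-- Lexicographic product G ∘ H, vertex (g,h) encoded via remQuot on Fin (|G| * |H|).
eqᵇ : ∀ {n} → Fin n → Fin n → Bool
eqᵇ x y = ⌊ x ≟ y ⌋

eqᵇ-sym : ∀ {n} (x y : Fin n) → eqᵇ x y ≡ eqᵇ y x
eqᵇ-sym x y with x ≟ y | y ≟ x
... | yes _ | yes _ = refl
... | no _  | no _  = refl
... | yes p | no q  = Data.Empty.⊥-elim (q (sym p))
  where import Data.Empty
... | no p  | yes q = Data.Empty.⊥-elim (p (sym q))
  where import Data.Empty

eqᵇ-refl : ∀ {n} (x : Fin n) → eqᵇ x x ≡ true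
eqᵇ-refl x with x ≟ x
... | yes _ = refl
... | no p  = Data.Empty.⊥-elim (p refl)
  where import Data.Empty

pairAdj : (G H : Graph) → V G × V H → V G × V H → Bool
pairAdj G H (g₁ , h₁) (g₂ , h₂) = adj G g₁ g₂ ∨ (eqᵇ g₁ g₂ ∧ adj H h₁ h₂)

pairAdj-sym : (G H : Graph) → ∀ p q → pairAdj G H p q ≡ pairAdj G H q p
pairAdj-sym G H (g₁ , h₁) (g₂ , h₂)
  rewrite adj-sym G g₁ g₂ | eqᵇ-sym g₁ g₂ | adj-sym H h₁ h₂ = refl

pairAdj-irr : (G H : Graph) → ∀ p → pairAdj G H p p ≡ false
pairAdj-irr G H (g , h) rewrite adj-irr G g | eqᵇ-refl g | adj-irr H h = refl

lexAdj : (G H : Graph) → Fin (order G * order H) → Fin (order G * order H) → Bool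
lexAdj G H x y = pairAdj G H (remQuot (order H) x) (remQuot (order H) y)

lexAdj-sym : (G H : Graph) → ∀ x y → lexAdj G H x y ≡ lexAdj G H y x
lexAdj-sym G H x y = pairAdj-sym G H (remQuot (order H) x) (remQuot (order H) y)

lexAdj-irr : (G H : Graph) → ∀ x → lexAdj G H x x ≡ false
lexAdj-irr G H x = pairAdj-irr G H (remQuot (order H) x)

_∘ₗ_ : Graph → Graph → Graph
G ∘ₗ H = record
  { order = order G * order H
  ; adj   = lexAdj G H
  ; adj-sym = lexAdj-sym G H
  ; adj-irr = lexAdj-irr G H
  }

sumFrom2 : ℕ → (ℕ → ℕ) → ℕ
sumFrom2 k f = sum (map (λ j → f (2 + j)) (upTo k))

-- Take maximum independent sets I_G, I_H and, for 2 ≤ i ≤ k + 1, a maximum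
-- i-packing P_i of G. The k vertices of H outside I_H can be listed as
-- h_2, …, h_{k+1}. Colour I_G × I_H with 1 (it is independent in G ∘ H) and
-- P_i × {h_i} with i: a walk in G ∘ H projects to a walk in G that is no
-- longer, so distances in G ∘ H dominate those between first coordinates.
-- These sets are pairwise disjoint, so every other vertex can get a fresh
-- colour, which uses 1 + k + (|G||H| − α(G)α(H) − Σ ρ_i(G)) colours. The
-- construction never needs H to have an edge.
module Submission where

open import Defs
open import Data.Bool using (Bool; true; false; _∧_; _∨_)
open import Data.Bool.Properties using (∧-zeroʳ)
open import Data.Nat using (ℕ; zero; suc; _+_; _*_; _∸_; _≤_; z≤n; s≤s)
open import Data.Nat.Properties using (≤-trans; n≤1+n; +-assoc; +-comm; +-suc; +-monoˡ-≤; m∸n+n≡m; module ≤-Reasoning)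
open import Data.Fin using (Fin; toℕ; punchIn; punchOut; _↑ˡ_; _↑ʳ_; splitAt; join; combine; remQuot)
  renaming (zero to fzero; suc to fsuc)
open import Data.Fin.Properties using (_≟_; ¬Fin0; any?; suc-injective; punchOut-injective; punchOut-cong; punchOut-punchIn; punchIn-punchOut; punchInᵢ≢i; punchIn-injective; toℕ-↑ˡ; ↑ˡ-injective; ↑ʳ-injective; splitAt-↑ˡ; splitAt-↑ʳ; join-splitAt; remQuot-combine; combine-remQuot; combine-injective; injective⇒≤)
open import Data.Product using (Σ; _,_; proj₁; proj₂; ∃)
open import Data.Sum using (_⊎_; inj₁; inj₂)
open import Data.Empty using (⊥-elim)
open import Data.List using (map; applyUpTo)
open import Data.Nat.ListAction using (sum)
open import Function using (id; _∘_)
open import Function.Definitions using (Injective)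
open import Relation.Nullary using (¬_; Dec; yes; no)
open import Relation.Binary.PropositionalEquality using (_≡_; _≢_; refl; sym; trans; cong; cong₂; subst; subst₂; module ≡-Reasoning)

↑ˡ≢↑ʳ : ∀ {m n} (i : Fin m) (j : Fin n) → i ↑ˡ n ≢ m ↑ʳ j
↑ˡ≢↑ʳ {m} {n} i j eq
  with () ← trans (sym (splitAt-↑ˡ m i n)) (trans (cong (splitAt m) eq) (splitAt-↑ʳ m n j))

distinct⇒injective : ∀ {m} {A : Set} (f : Fin m → A)
  → (∀ i j → i ≢ j → f i ≢ f j) → Injective _≡_ _≡_ f
distinct⇒injective f distinct {i} {j} eq with i ≟ j
... | yes i≡j = i≡j
... | no i≢j = ⊥-elim (distinct i j i≢j eq)

record Complement {T n : ℕ} (e : Fin T → Fin n) : Set where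
  field
    enum           : Fin (n ∸ T) → Fin n
    enum-injective : Injective _≡_ _≡_ enum
    enum-avoids    : ∀ i j → e j ≢ enum i
    enum-covers    : ∀ v → (∀ j → e j ≢ v) → ∃ λ i → enum i ≡ v

-- Removing p = e 0 from Fin (suc n) via punchOut p reduces to the complement
-- of the remaining T values in Fin n; punchIn p carries it back.
complement : ∀ {T n} (e : Fin T → Fin n) → Injective _≡_ _≡_ e → Complement e
complement {zero} e _ = record
  { enum = id ; enum-injective = id ; enum-avoids = λ _ () ; enum-covers = λ v _ → v , refl }
complement {suc T} {zero} e _ = ⊥-elim (¬Fin0 (e fzero))
complement {suc T} {suc n} e e-injective = record
  { enum = enum ; enum-injective = enum-injective ; enum-avoids = enum-avoids ; enum-covers = enum-covers }
  where
  p : Fin (suc n)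
  p = e fzero

  p≢e : ∀ j → p ≢ e (fsuc j)
  p≢e j eq with () ← e-injective {fzero} {fsuc j} eq

  e′ : Fin T → Fin n
  e′ j = punchOut (p≢e j)

  e′-injective : Injective _≡_ _≡_ e′
  e′-injective {i} {j} eq =
    suc-injective (e-injective {fsuc i} {fsuc j} (punchOut-injective (p≢e i) (p≢e j) eq))

  module C = Complement (complement e′ e′-injective)

  enum : Fin (n ∸ T) → Fin (suc n)
  enum = punchIn p ∘ C.enum

  enum-injective : Injective _≡_ _≡_ enum
  enum-injective eq = C.enum-injective (punchIn-injective p _ _ eq)

  enum-avoids : ∀ i j → e j ≢ enum i
  enum-avoids i fzero eq = punchInᵢ≢i p (C.enum i) (sym eq)
  enum-avoids i (fsuc j) eq = C.enum-avoids i j (trans (punchOut-cong p eq) (punchOut-punchIn p))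

  enum-covers : ∀ v → (∀ j → e j ≢ v) → ∃ λ i → enum i ≡ v
  enum-covers v v∉e =
    let i , i↦v′ = C.enum-covers (punchOut (v∉e fzero)) v′∉e′
    in  i , trans (cong (punchIn p) i↦v′) (punchIn-punchOut (v∉e fzero))
    where
    v′∉e′ : ∀ j → e′ j ≢ punchOut (v∉e fzero)
    v′∉e′ j eq = v∉e (fsuc j) (punchOut-injective (p≢e j) (v∉e fzero) eq)

record PartialPackingColoring (X : Graph) (K T : ℕ) : Set where
  field
    vertex           : Fin T → V X
    colour           : Fin T → Fin K
    vertex-injective : Injective _≡_ _≡_ vertex
    packing          : ∀ a b → vertex a ≢ vertex b → colour a ≡ colour b
                     → DistGt X (vertex a) (vertex b) (suc (toℕ (colour a)))

extendPackingColoring : ∀ {X K T} → PartialPackingColoring X K T → HasPackingColoring X (K + (order X ∸ T))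
extendPackingColoring {X} {K} {T} P = colouring , λ u v u≢v → valid u≢v (image? u) (image? v)
  where
  open PartialPackingColoring P
  open Complement (complement vertex vertex-injective)

  Image : V X → Set
  Image v = ∃ λ a → vertex a ≡ v

  image? : ∀ v → Dec (Image v)
  image? v = any? (λ a → vertex a ≟ v)

  index : ∀ v → ¬ Image v → Fin (order X ∸ T)
  index v v∉ = proj₁ (enum-covers v (λ a eq → v∉ (a , eq)))

  enum-index : ∀ v v∉ → enum (index v v∉) ≡ v
  enum-index v v∉ = proj₂ (enum-covers v (λ a eq → v∉ (a , eq)))

  colourOf : ∀ v → Dec (Image v) → Fin (K + (order X ∸ T))
  colourOf v (yes (a , _)) = colour a ↑ˡ (order X ∸ T)
  colourOf v (no v∉)       = K ↑ʳ index v v∉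

  colouring : V X → Fin (K + (order X ∸ T))
  colouring v = colourOf v (image? v)

  valid : ∀ {u v} → u ≢ v → (u? : Dec (Image u)) (v? : Dec (Image v)) → colourOf u u? ≡ colourOf v v?
        → DistGt X u v (suc (toℕ (colourOf u u?)))
  valid u≢v (yes (a , refl)) (yes (b , refl)) eq
    rewrite toℕ-↑ˡ (colour a) (order X ∸ T) = packing a b u≢v (↑ˡ-injective _ _ _ eq)
  valid _ (yes _) (no _) eq = ⊥-elim (↑ˡ≢↑ʳ _ _ eq)
  valid _ (no _) (yes _) eq = ⊥-elim (↑ˡ≢↑ʳ _ _ (sym eq))
  valid {u} {v} u≢v (no u∉) (no v∉) eq = ⊥-elim (u≢v (begin
    u                    ≡⟨ sym (enum-index u u∉) ⟩
    enum (index u u∉)    ≡⟨ cong enum (↑ʳ-injective K _ _ eq) ⟩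
    enum (index v v∉)    ≡⟨ enum-index v v∉ ⟩
    v                    ∎))
    where open ≡-Reasoning

packingChromatic-bound : ∀ {X K T χ} → IsPackingChromaticNumber X χ → PartialPackingColoring X K T
  → χ + T ≤ K + order X
packingChromatic-bound {X} {K} {T} {χ} (_ , χ-minimal) P = begin
  χ + T                    ≤⟨ +-monoˡ-≤ T (χ-minimal _ (extendPackingColoring P)) ⟩
  K + (order X ∸ T) + T    ≡⟨ +-assoc K (order X ∸ T) T ⟩
  K + (order X ∸ T + T)    ≡⟨ cong (K +_) (m∸n+n≡m (injective⇒≤ vertex-injective)) ⟩
  K + order X              ∎
  where
  open ≤-Reasoning
  open PartialPackingColoring P

nonadjacent⇒DistGt1 : (X : Graph) {x y : V X} → x ≢ y → adj X x y ≡ false → DistGt X x y 1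
nonadjacent⇒DistGt1 X x≢y _ (zero , _ , here) = x≢y refl
nonadjacent⇒DistGt1 X _ x≁y (suc zero , _ , step x∼y here) with () ← trans (sym x∼y) x≁y
nonadjacent⇒DistGt1 X _ _ (suc (suc _) , s≤s () , _)

packing-injective : (X : Graph) {t m : ℕ} (f : Fin m → V X)
  → (∀ i j → i ≢ j → DistGt X (f i) (f j) t) → Injective _≡_ _≡_ f
packing-injective X f far = distinct⇒injective f λ i j i≢j fi≡fj →
  far i j i≢j (0 , z≤n , subst (λ y → Walk X (f i) y 0) fi≡fj here)

∨-eqᵇ-true : ∀ {n} (a : Bool) (g g′ : Fin n) (b : Bool) → a ∨ (eqᵇ g g′ ∧ b) ≡ true → a ≡ true ⊎ g ≡ g′
∨-eqᵇ-true true  _ _  _ _ = inj₁ refl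
∨-eqᵇ-true false g g′ _ _ with g ≟ g′
∨-eqᵇ-true false g g′ _ _  | yes g≡g′ = inj₂ g≡g′
∨-eqᵇ-true false g g′ _ () | no _

module _ (G H : Graph) where

  first : V (G ∘ₗ H) → V G
  first x = proj₁ (remQuot (order H) x)

  first-combine : ∀ g h → first (combine g h) ≡ g
  first-combine g h = cong proj₁ (remQuot-combine g h)

  walk-first : ∀ {x y ℓ} → Walk (G ∘ₗ H) x y ℓ → DistLe G (first x) (first y) ℓ
  walk-first here = 0 , z≤n , here
  walk-first {x} (step {w = w} {ℓ = ℓ} x∼w rest)
    with ℓ′ , ℓ′≤ℓ , w′ ← walk-first rest
       | ∨-eqᵇ-true (adj G (first x) (first w)) (first x) (first w) _ x∼w
  ... | inj₁ fx∼fw  = suc ℓ′ , s≤s ℓ′≤ℓ , step fx∼fw w′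
  ... | inj₂ fx≡fw = ℓ′ , ≤-trans ℓ′≤ℓ (n≤1+n ℓ) , subst (λ z → Walk G z _ ℓ′) (sym fx≡fw) w′

  DistGt-combine : ∀ {g g′ h h′ d} → DistGt G g g′ d → DistGt (G ∘ₗ H) (combine g h) (combine g′ h′) d
  DistGt-combine {g} {g′} {h} {h′} far (ℓ , ℓ≤d , w) =
    let ℓ′ , ℓ′≤ℓ , w′ = walk-first w
    in  far (ℓ′ , ≤-trans ℓ′≤ℓ ℓ≤d , subst₂ (λ a b → Walk G a b ℓ′) (first-combine g h) (first-combine g′ h′) w′)

  combine-nonadjacent : ∀ {g g′ h h′} → adj G g g′ ≡ false → adj H h h′ ≡ false
    → adj (G ∘ₗ H) (combine g h) (combine g′ h′) ≡ false
  combine-nonadjacent {g} {g′} {h} {h′} g≁g′ h≁h′ = begin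
    pairAdj G H (remQuot (order H) (combine g h)) (remQuot (order H) (combine g′ h′))
      ≡⟨ cong₂ (pairAdj G H) (remQuot-combine g h) (remQuot-combine g′ h′) ⟩
    adj G g g′ ∨ (eqᵇ g g′ ∧ adj H h h′)
      ≡⟨ cong₂ (λ a b → a ∨ (eqᵇ g g′ ∧ b)) g≁g′ h≁h′ ⟩
    eqᵇ g g′ ∧ false
      ≡⟨ ∧-zeroʳ (eqᵇ g g′) ⟩
    false ∎
    where open ≡-Reasoning

∑ : (n : ℕ) → (Fin n → ℕ) → ℕ
∑ zero    g = 0
∑ (suc n) g = g fzero + ∑ n (g ∘ fsuc)

sum-map-applyUpTo : ∀ n (f g : ℕ → ℕ) → sum (map g (applyUpTo f n)) ≡ ∑ n (g ∘ f ∘ toℕ)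
sum-map-applyUpTo zero    f g = refl
sum-map-applyUpTo (suc n) f g = cong (g (f 0) +_) (sum-map-applyUpTo n (f ∘ suc) g)

splitΣ : ∀ n (g : Fin n → ℕ) → Fin (∑ n g) → Σ (Fin n) (Fin ∘ g)
splitΣ (suc n) g x with splitAt (g fzero) x
... | inj₁ t = fzero , t
... | inj₂ r = let i , t = splitΣ n (g ∘ fsuc) r in fsuc i , t

joinΣ : ∀ n (g : Fin n → ℕ) → Σ (Fin n) (Fin ∘ g) → Fin (∑ n g)
joinΣ (suc n) g (fzero , t)  = t ↑ˡ ∑ n (g ∘ fsuc)
joinΣ (suc n) g (fsuc i , t) = g fzero ↑ʳ joinΣ n (g ∘ fsuc) (i , t)

joinΣ-splitΣ : ∀ n g x → joinΣ n g (splitΣ n g x) ≡ x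
joinΣ-splitΣ (suc n) g x with splitAt (g fzero) x in eq
... | inj₁ t = trans (cong (join (g fzero) _) (sym eq)) (join-splitAt (g fzero) _ x)
... | inj₂ r = trans (cong (g fzero ↑ʳ_) (joinΣ-splitΣ n (g ∘ fsuc) r))
                     (trans (cong (join (g fzero) _) (sym eq)) (join-splitAt (g fzero) _ x))

module LexPackingColoring (G H : Graph) {αG αH : ℕ} (ρ : ℕ → ℕ)
  (IG : HasIndependent G αG) (IH : HasIndependent H αH)
  (P : ∀ i → HasPacking G (2 + i) (ρ (2 + i))) where

  k : ℕ
  k = order H ∸ αH

  layerSize : Fin k → ℕ
  layerSize i = ρ (2 + toℕ i)

  T : ℕ
  T = αG * αH + ∑ k layerSize

  private
    iG : Fin αG → V G
    iG = proj₁ IG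

    iH : Fin αH → V H
    iH = proj₁ IH

    iG-injective : Injective _≡_ _≡_ iG
    iG-injective = distinct⇒injective iG (proj₁ (proj₂ IG))

    iH-injective : Injective _≡_ _≡_ iH
    iH-injective = distinct⇒injective iH (proj₁ (proj₂ IH))

    open Complement (complement iH iH-injective)
      renaming (enum to outsideH; enum-injective to outsideH-injective; enum-avoids to outsideH-avoids)

    layerVertex : (i : Fin k) → Fin (layerSize i) → V G
    layerVertex i = proj₁ (P (toℕ i))

    layer-far : ∀ i t t′ → t ≢ t′ → DistGt G (layerVertex i t) (layerVertex i t′) (2 + toℕ i)
    layer-far i = proj₂ (P (toℕ i))

  data Marked : Set where
    core  : Fin αG → Fin αH → Marked
    layer : (i : Fin k) → Fin (layerSize i) → Marked

  position : Marked → V (G ∘ₗ H)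
  position (core a b)  = combine (iG a) (iH b)
  position (layer i t) = combine (layerVertex i t) (outsideH i)

  colourOf : Marked → Fin (suc k)
  colourOf (core _ _)  = fzero
  colourOf (layer i _) = fsuc i

  position-injective : Injective _≡_ _≡_ position
  position-injective {core a b} {core a′ b′} eq
    with refl ← iG-injective (proj₁ (combine-injective (iG a) (iH b) (iG a′) (iH b′) eq))
       | refl ← iH-injective (proj₂ (combine-injective (iG a) (iH b) (iG a′) (iH b′) eq)) = refl
  position-injective {core a b} {layer i t} eq =
    ⊥-elim (outsideH-avoids i b (proj₂ (combine-injective (iG a) (iH b) (layerVertex i t) (outsideH i) eq)))
  position-injective {layer i t} {core a b} eq =
    ⊥-elim (outsideH-avoids i b (sym (proj₂ (combine-injective (layerVertex i t) (outsideH i) (iG a) (iH b) eq))))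
  position-injective {layer i t} {layer i′ t′} eq
    with refl ← outsideH-injective (proj₂ (combine-injective (layerVertex i t) (outsideH i) (layerVertex i′ t′) (outsideH i′) eq))
    with refl ← packing-injective G (layerVertex i) (layer-far i)
                  (proj₁ (combine-injective (layerVertex i t) (outsideH i) (layerVertex i t′) (outsideH i) eq)) = refl

  position-packing : ∀ c c′ → position c ≢ position c′ → colourOf c ≡ colourOf c′
    → DistGt (G ∘ₗ H) (position c) (position c′) (suc (toℕ (colourOf c)))
  position-packing (core a b) (core a′ b′) c≢c′ _ =
    nonadjacent⇒DistGt1 (G ∘ₗ H) c≢c′ (combine-nonadjacent G H (proj₂ (proj₂ IG) a a′) (proj₂ (proj₂ IH) b b′))
  position-packing (core _ _) (layer _ _) _ ()
  position-packing (layer _ _) (core _ _) _ ()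
  position-packing (layer i t) (layer i′ t′) c≢c′ eq with refl ← suc-injective eq =
    DistGt-combine G H (layer-far i t t′ (c≢c′ ∘ cong (λ s → position (layer i s))))

  encode : Fin T → Marked
  encode x with splitAt (αG * αH) x
  ... | inj₁ a = let g , h = remQuot αH a in core g h
  ... | inj₂ s = let i , t = splitΣ k layerSize s in layer i t

  decode : Marked → Fin T
  decode (core a b)  = combine a b ↑ˡ ∑ k layerSize
  decode (layer i t) = αG * αH ↑ʳ joinΣ k layerSize (i , t)

  decode-encode : ∀ x → decode (encode x) ≡ x
  decode-encode x with splitAt (αG * αH) x in eq
  ... | inj₁ a = trans (cong (_↑ˡ ∑ k layerSize) (combine-remQuot {αG} αH a))
                       (trans (cong (join (αG * αH) (∑ k layerSize)) (sym eq)) (join-splitAt (αG * αH) (∑ k layerSize) x))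
  ... | inj₂ s = trans (cong (αG * αH ↑ʳ_) (joinΣ-splitΣ k layerSize s))
                       (trans (cong (join (αG * αH) (∑ k layerSize)) (sym eq)) (join-splitAt (αG * αH) (∑ k layerSize) x))

  encode-injective : Injective _≡_ _≡_ encode
  encode-injective {x} {y} eq = trans (sym (decode-encode x)) (trans (cong decode eq) (decode-encode y))

  partialColoring : PartialPackingColoring (G ∘ₗ H) (suc k) T
  partialColoring = record
    { vertex           = position ∘ encode
    ; colour           = colourOf ∘ encode
    ; vertex-injective = encode-injective ∘ position-injective
    ; packing          = λ a b → position-packing (encode a) (encode b)
    }

theorem2p2 : (G H : Graph) (αG αH χ : ℕ) (ρ : ℕ → ℕ)
    → IsIndependenceNumber G αG
    → IsIndependenceNumber H αH
    → (∀ i → 1 ≤ i → IsPackingNumber G i (ρ i))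
    → ¬ Edgeless H
    → IsPackingChromaticNumber (G ∘ₗ H) χ
    → χ + αG * αH + sumFrom2 (∣ H ∣ᵥ ∸ αH) ρ
        ≤ ∣ G ∣ᵥ * ∣ H ∣ᵥ + (∣ H ∣ᵥ ∸ αH) + 1
theorem2p2 G H αG αH χ ρ (IG , _) (IH , _) packing _ χ-optimal = begin
  χ + αG * αH + sumFrom2 k ρ    ≡⟨ cong (χ + αG * αH +_) (sum-map-applyUpTo k id (λ j → ρ (2 + j))) ⟩
  χ + αG * αH + ∑ k layerSize  ≡⟨ +-assoc χ (αG * αH) _ ⟩
  χ + T                         ≤⟨ packingChromatic-bound χ-optimal partialColoring ⟩
  suc k + NM                    ≡⟨ +-comm (suc k) NM ⟩
  NM + suc k                    ≡⟨ +-suc NM k ⟩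
  suc (NM + k)                  ≡⟨ +-comm 1 (NM + k) ⟩
  NM + k + 1                    ∎
  where
  open ≤-Reasoning
  open LexPackingColoring G H ρ IG IH (λ i → proj₁ (packing (2 + i) (s≤s z≤n)))
  NM : ℕ
  NM = ∣ G ∣ᵥ * ∣ H ∣ᵥ
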